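{- If $S\subseteq\widetilde{A^{\mathbb N_1}}$ is effectively closed, then $\mathcal D_S=\bigcup_{\alpha\in S}\mathcal D_\alpha\subseteq A^{\mathbb Z}$ is an effective subshift.
   Context: $\mathbb N_1=\mathbb N\setminus\{0\}$, $A$ a finite alphabet. A $1$-net is a family $(2^n\mathbb Z+k_n)_{n\in\mathbb N_1}$ of pairwise disjoint subsets of $\mathbb Z$ ($k_n\in\mathbb Z$). For $\alpha\in A^{\mathbb N_1}$, $\mathcal D_\alpha\subseteq A^{\mathbb Z}$ is the set of $x$ for which there is a $1$-net with $x_i=\alpha_n$ for all $n\in\mathbb N_1$, $i\in2^n\mathbb Z+k_n$. For $\alpha,\beta\in A^{\mathbb N_1}$, $\alpha\sim\beta$ means $\alpha=\beta$ or there is $i\in\mathbb N_1$ with $\alpha_j=\beta_j$ for $j<i$ and $\alpha_i=\beta_j$, $\alpha_j=\beta_i$ for all $j>i$; $\widetilde{A^{\mathbb N_1}}$ is the quotient by this equivalence relation, and $\mathcal D_\alpha$ depends only on the class of $\alpha$. A subset of $A^{\mathbb N_1}$ (resp. $A^{\mathbb Z}$) is effectively closed if its complement is the union of a computable sequence of cylinder sets (sets of configurations with a prescribed finite pattern); a set $S$ of classes is effectively closed if the set of sequences whose class lies in $S$ is effectively closed in $A^{\mathbb N_1}$. An effective subshift is an effectively closed subset of $A^{\mathbb Z}$ that is shift-invariant. -}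

module Defs where

open import Data.Nat as ℕ using (ℕ; zero; suc; _<_; _^_)
open import Data.Integer as ℤ using (ℤ; +_; -[1+_])
open import Data.Fin using (Fin; toℕ)
open import Data.Vec using (Vec; []; _∷_; lookup)
open import Data.List using (List; []; _∷_)
open import Data.List.Relation.Unary.All using (All)
open import Data.Maybe using (Maybe; just; nothing; _>>=_)
open import Data.Product using (Σ; _×_; _,_; ∃; proj₁; proj₂)
open import Data.Sum using (_⊎_)
open import Relation.Binary.PropositionalEquality using (_≡_; _≢_)
open import Relation.Nullary using (¬_)
open import Function.Bundles using (_⇔_)

data Code : ℕ → Set where
  zeroC : ∀ {n} → Code n
  succC : Code 1
  projC : ∀ {n} → Fin n → Code n
  compC : ∀ {m n} → Code m → Vec (Code n) m → Code n
  recC  : ∀ {n} → Code n → Code (suc (suc n)) → Code (suc n)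
    -- primitive recursion: h(0,v)=f(v), h(x+1,v)=g(x,h(x,v),v)
  muC   : ∀ {n} → Code (suc n) → Code n
    -- minimisation: least i with f(i,v)=0 (all earlier values defined)

mutual
  eval : ∀ {n} → ℕ → Code n → Vec ℕ n → Maybe ℕ
  eval zero    _           _        = nothing
  eval (suc k) zeroC       _        = just 0
  eval (suc k) succC       (x ∷ []) = just (suc x)
  eval (suc k) (projC i)   v        = just (lookup v i)
  eval (suc k) (compC f gs) v       = evalVec k gs v >>= λ ws → eval k f ws
  eval (suc k) (recC f g)  (x ∷ v)  = recLoop k f g x v
  eval (suc k) (muC f)     v        = muLoop k f v 0

  evalVec : ∀ {m n} → ℕ → Vec (Code n) m → Vec ℕ n → Maybe (Vec ℕ m)
  evalVec k []       v = just []
  evalVec k (g ∷ gs) v = eval k g v >>= λ w → evalVec k gs v >>= λ ws → just (w ∷ ws)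

  recLoop : ∀ {n} → ℕ → Code n → Code (suc (suc n)) → ℕ → Vec ℕ n → Maybe ℕ
  recLoop k f g zero    v = eval k f v
  recLoop k f g (suc x) v = recLoop k f g x v >>= λ r → eval k g (x ∷ r ∷ v)

  muLoop : ∀ {n} → ℕ → Code (suc n) → Vec ℕ n → ℕ → Maybe ℕ
  muLoop zero    f v i = nothing
  muLoop (suc k) f v i with eval k f (i ∷ v)
  ... | nothing      = nothing
  ... | just zero    = just i
  ... | just (suc _) = muLoop k f v (suc i)

Computable : (ℕ → ℕ) → Set
Computable f = Σ (Code 1) λ c → ∀ n → ∃ λ fuel → eval fuel c (n ∷ []) ≡ just (f n)

-- Cantor enumeration of ℕ × ℕ (structural recursion).
unpair : ℕ → ℕ × ℕ
unpair zero    = 0 , 0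
unpair (suc n) with unpair n
... | a , zero  = 0 , suc a
... | a , suc b = suc a , b

decodeℤ : ℕ → ℤ
decodeℤ n with unpair n
... | zero  , m = + m
... | suc _ , m = -[1+ m ]

decodeListN : ℕ → ℕ → List (ℕ × ℕ)
decodeListN zero    _ = []
decodeListN (suc l) n = unpair (proj₁ (unpair n)) ∷ decodeListN l (proj₂ (unpair n))

-- code ↦ list of pairs (position code , letter code)
decodeList : ℕ → List (ℕ × ℕ)
decodeList n = decodeListN (proj₁ (unpair n)) (proj₂ (unpair n))

-- A pattern on ℤ: finitely many (position , letter); letter codes ≥ k or
-- contradictory entries give the empty cylinder.
Patternℤ : Set
Patternℤ = List (ℤ × ℕ)

mapPos : List (ℕ × ℕ) → Patternℤ
mapPos []            = []
mapPos ((i , a) ∷ p) = (decodeℤ i , a) ∷ mapPos p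

decodePatℤ : ℕ → Patternℤ
decodePatℤ n = mapPos (decodeList n)

-- A pattern on ℕ₁ (position i in the list stands for index i+1)
decodePatℕ : ℕ → List (ℕ × ℕ)
decodePatℕ = decodeList

Conf : ℕ → Set
Conf k = ℤ → Fin k

-- sequences in A^{ℕ₁}, shifted: α i stands for α_{i+1}
Seq : ℕ → Set
Seq k = ℕ → Fin k

inCylℤ : ∀ {k} → Conf k → Patternℤ → Set
inCylℤ x p = All (λ q → toℕ (x (proj₁ q)) ≡ proj₂ q) p

inCylℕ : ∀ {k} → Seq k → List (ℕ × ℕ) → Set
inCylℕ α p = All (λ q → toℕ (α (proj₁ q)) ≡ proj₂ q) p

EffClosedℤ : ∀ {k} → (Conf k → Set) → Set
EffClosedℤ X = Σ (ℕ → ℕ) λ f → Computable f ×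
  (∀ x → (¬ X x) ⇔ (∃ λ n → inCylℤ x (decodePatℤ (f n))))

EffClosedℕ : ∀ {k} → (Seq k → Set) → Set
EffClosedℕ X = Σ (ℕ → ℕ) λ f → Computable f ×
  (∀ α → (¬ X α) ⇔ (∃ λ n → inCylℕ α (decodePatℕ (f n))))

-- 1-nets.  Level n ∈ ℕ (standing for n+1 ∈ ℕ₁) is 2^{n+1} ℤ + kk n.

InLevel : (ℕ → ℤ) → ℕ → ℤ → Set
InLevel kk n i = ∃ λ (z : ℤ) → i ≡ z ℤ.* (+ (2 ^ suc n)) ℤ.+ kk n

IsNet : (ℕ → ℤ) → Set
IsNet kk = ∀ m n → m ≢ n → ∀ i → ¬ (InLevel kk m i × InLevel kk n i)

D : ∀ {k} → Seq k → Conf k → Set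
D α x = Σ (ℕ → ℤ) λ kk → IsNet kk × (∀ n i → InLevel kk n i → x i ≡ α n)

_∼_ : ∀ {k} → Seq k → Seq k → Set
α ∼ β = (∀ j → α j ≡ β j)
      ⊎ (∃ λ i → (∀ j → j < i → α j ≡ β j)
                × (∀ j → i < j → α i ≡ β j)
                × (∀ j → i < j → α j ≡ β i))

-- a set of classes, represented as a ∼-saturated set of sequences
Saturated : ∀ {k} → (Seq k → Set) → Set
Saturated {k} S = ∀ (α β : Seq k) → α ∼ β → S α → S β

DS : ∀ {k} → (Seq k → Set) → Conf k → Set
DS S x = ∃ λ α → S α × D α x

shift : ∀ {k} → Conf k → Conf k
shift x i = x (i ℤ.+ + 1)

ShiftInvariant : ∀ {k} → (Conf k → Set) → Set
ShiftInvariant X = ∀ x → X x ⇔ X (shift x)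

EffectiveSubshift : ∀ {k} → (Conf k → Set) → Set
EffectiveSubshift X = EffClosedℤ X × ShiftInvariant X

-- A word on the first N positions of ℤ is forbidden when no depth-N approximation of a point
-- of 𝒟_S fits it: letters α₀ … α_{N-1} < k and offsets r_n < 2^{n+1} whose levels are disjoint
-- and carry the letters of the word on those positions, with α avoiding the first N cylinders
-- enumerated for the complement of S. The candidates are bounded, so being forbidden is
-- primitive recursive relative to that enumeration. A point of 𝒟_S contains no forbidden word.
-- Conversely, if no word of x is forbidden, x has approximations of every depth, and König's
-- lemma (hence excluded middle) glues them into a net and a sequence α ∈ S with x ∈ 𝒟_α.
module Submission where

open import Defs
open import Axiom.ExcludedMiddle using (ExcludedMiddle)
open import Axiom.DoubleNegationElimination using (em⇒dne)
open import Level using (0ℓ)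
open import Data.Nat as ℕ
  using (ℕ; zero; suc; _+_; _*_; _∸_; _^_; _≤_; _<_; _⊔_; z≤n; s≤s; s≤s⁻¹; z<s; ∣_-_∣)
open import Data.Nat.Properties
open import Data.Nat.DivMod using (_%_; _/_; %-congˡ; m≡m%n+[m/n]*n; [m+kn]%n≡m%n; m%n<n; n%n≡0; m<n⇒m%n≡m)
open import Data.Nat.Divisibility using (_∣_; m%n≡0⇔n∣m)
open import Data.Integer as ℤ using (ℤ; +_; -[1+_])
open import Data.Integer.DivMod using (_%ℕ_; _/ℕ_; n%ℕd<d; a≡a%ℕn+[a/ℕn]*n)
import Data.Integer.Properties as ℤ
import Data.Integer.Divisibility.Signed as ℤ∣
open import Data.Integer.Tactic.RingSolver using (solve-∀)
open import Data.Fin using (Fin; toℕ; fromℕ<) renaming (zero to fzero; suc to fsuc)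
open import Data.Fin.Properties using (toℕ<n; toℕ-injective; toℕ-fromℕ<)
open import Data.Vec using (Vec; []; _∷_; lookup; tabulate; head; tail)
open import Data.Vec.Properties using (tabulate∘lookup)
open import Data.Vec.N-ary using (_$ⁿ_)
open import Data.List using (List; []; _∷_; applyDownFrom)
open import Data.List.Relation.Unary.All as All using (All; []; _∷_)
open import Data.Maybe using (just; _>>=_)
open import Data.Product using (Σ; _×_; _,_; ∃; proj₁; proj₂; uncurry)
open import Data.Product.Function.NonDependent.Propositional using (_×-⇔_)
open import Data.Sum using (_⊎_; inj₁; inj₂)
open import Data.Empty using (⊥-elim)
open import Relation.Nullary using (¬_; yes; no)
open import Relation.Binary.PropositionalEquality
import Relation.Binary.Reasoning.Setoid as SetoidReasoning
open import Function.Base using (_∘_; case_of_)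
open import Function.Bundles using (_⇔_; mk⇔; Equivalence)
import Function.Properties.Equivalence as ⇔
open import Function.Related.TypeIsomorphisms using (→-cong-⇔)

module ⇔-Reasoning = SetoidReasoning (⇔.⇔-setoid 0ℓ)

-- Natural numbers as truth values, 0 being true
if0_then_else_ : ℕ → ℕ → ℕ → ℕ
if0 zero  then a else b = a
if0 suc _ then a else b = b

notᵗ : ℕ → ℕ
notᵗ b = 1 ∸ b

sum< : ℕ → (ℕ → ℕ) → ℕ
sum< zero    f = 0
sum< (suc n) f = sum< n f + f n

m≡0∧n≡0⇒m+n≡0 : ∀ {m n} → m ≡ 0 → n ≡ 0 → m + n ≡ 0
m≡0∧n≡0⇒m+n≡0 refl refl = refl

notᵗ≡0⇔≢0 : ∀ b → notᵗ b ≡ 0 ⇔ b ≢ 0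
notᵗ≡0⇔≢0 zero    = mk⇔ (λ ()) (λ b≢0 → ⊥-elim (b≢0 refl))
notᵗ≡0⇔≢0 (suc b) = mk⇔ (λ _ ()) (λ _ → 0∸n≡0 b)

notᵗ≢0⇒≡0 : ∀ b → notᵗ b ≢ 0 → b ≡ 0
notᵗ≢0⇒≡0 zero    _  = refl
notᵗ≢0⇒≡0 (suc b) ne = ⊥-elim (ne (0∸n≡0 b))

All< : ℕ → (ℕ → Set) → Set
All< n P = ∀ j → j < n → P j

Agree : ℕ → (ℕ → ℕ) → (ℕ → ℕ) → Set
Agree N f f′ = All< N (λ j → f j ≡ f′ j)

All<-cong : ∀ n {P Q : ℕ → Set} → (∀ j → P j ⇔ Q j) → All< n P ⇔ All< n Q
All<-cong n P⇔Q = mk⇔ (λ h j j<n → Equivalence.to (P⇔Q j) (h j j<n)) (λ h j j<n → Equivalence.from (P⇔Q j) (h j j<n))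

m+n≡0⇔ : ∀ m n → m + n ≡ 0 ⇔ (m ≡ 0 × n ≡ 0)
m+n≡0⇔ m n = mk⇔ (λ e → m+n≡0⇒m≡0 m e , m+n≡0⇒n≡0 m e) (λ (e₁ , e₂) → m≡0∧n≡0⇒m+n≡0 e₁ e₂)

1+m∸n≡0⇔m<n : ∀ m n → suc m ∸ n ≡ 0 ⇔ m < n
1+m∸n≡0⇔m<n m n = mk⇔ m∸n≡0⇒m≤n m≤n⇒m∸n≡0

∣m-n∣≡0⇔m≡n : ∀ m n → ∣ m - n ∣ ≡ 0 ⇔ m ≡ n
∣m-n∣≡0⇔m≡n m n = mk⇔ ∣m-n∣≡0⇒m≡n m≡n⇒∣m-n∣≡0

notᵗp*q≡0⇔ : ∀ p q → notᵗ p * q ≡ 0 ⇔ (p ≡ 0 → q ≡ 0)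
notᵗp*q≡0⇔ zero    q = mk⇔ (λ e _ → trans (sym (+-identityʳ q)) e) (λ h → trans (+-identityʳ q) (h refl))
notᵗp*q≡0⇔ (suc p) q = mk⇔ (λ _ ()) (λ _ → cong (_* q) (0∸n≡0 p))

sum<≡0⇔ : ∀ n f → sum< n f ≡ 0 ⇔ All< n (λ j → f j ≡ 0)
sum<≡0⇔ n f = mk⇔ (to n) (from n)
  where
  to : ∀ n → sum< n f ≡ 0 → ∀ j → j < n → f j ≡ 0
  to (suc n) e j j<1+n with m≤n⇒m<n∨m≡n (s≤s⁻¹ j<1+n)
  ... | inj₁ j<n  = to n (m+n≡0⇒m≡0 (sum< n f) e) j j<n
  ... | inj₂ refl = m+n≡0⇒n≡0 (sum< n f) e
  from : ∀ n → (∀ j → j < n → f j ≡ 0) → sum< n f ≡ 0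
  from zero    h = refl
  from (suc n) h = m≡0∧n≡0⇒m+n≡0 (from n (λ j j<n → h j (m<n⇒m<1+n j<n))) (h n ≤-refl)

sum<≢0⇒∃ : ∀ n f → sum< n f ≢ 0 → ∃ λ j → j < n × f j ≢ 0
sum<≢0⇒∃ zero    f ne = ⊥-elim (ne refl)
sum<≢0⇒∃ (suc n) f ne with f n ℕ.≟ 0
... | no fn≢0 = n , ≤-refl , fn≢0
... | yes fn≡0 =
  let (j , j<n , fj≢0) = sum<≢0⇒∃ n f (λ e → ne (m≡0∧n≡0⇒m+n≡0 e fn≡0)) in j , m<n⇒m<1+n j<n , fj≢0

∣m-n∣≡m∸n+n∸m : ∀ m n → ∣ m - n ∣ ≡ (m ∸ n) + (n ∸ m)
∣m-n∣≡m∸n+n∸m zero    zero    = refl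
∣m-n∣≡m∸n+n∸m zero    (suc n) = refl
∣m-n∣≡m∸n+n∸m (suc m) zero    = sym (+-identityʳ (suc m))
∣m-n∣≡m∸n+n∸m (suc m) (suc n) = ∣m-n∣≡m∸n+n∸m m n

triangle : ℕ → ℕ
triangle zero    = 0
triangle (suc s) = triangle s + suc s

pair : ℕ → ℕ → ℕ
pair a b = triangle (a + b) + a

unpair-step : ℕ × ℕ → ℕ × ℕ
unpair-step (a , zero)  = 0 , suc a
unpair-step (a , suc b) = suc a , b

unpair-suc : ∀ n → unpair (suc n) ≡ unpair-step (unpair n)
unpair-suc n with unpair n
... | a , zero  = refl
... | a , suc b = refl

pair-sucˡ : ∀ a b → pair (suc a) b ≡ suc (pair a (suc b))
pair-sucˡ a b = begin
  triangle (suc (a + b)) + suc a   ≡⟨ +-suc _ a ⟩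
  suc (triangle (suc (a + b)) + a) ≡⟨ cong (λ s → suc (triangle s + a)) (sym (+-suc a b)) ⟩
  suc (triangle (a + suc b) + a)   ∎
  where open ≡-Reasoning

pair-zero-suc : ∀ c → pair 0 (suc c) ≡ suc (pair c 0)
pair-zero-suc c rewrite +-identityʳ (triangle c + suc c) | +-identityʳ c = +-suc (triangle c) c

pair-unpair : ∀ n → uncurry pair (unpair n) ≡ n
pair-unpair zero    = refl
pair-unpair (suc n) rewrite unpair-suc n = next (unpair n) (pair-unpair n)
  where
  next : ∀ p → uncurry pair p ≡ n → uncurry pair (unpair-step p) ≡ suc n
  next (a , zero)  e = trans (pair-zero-suc a) (cong suc e)
  next (a , suc b) e = trans (pair-sucˡ a b) (cong suc e)

-- unpair walks each diagonal a + b = s from (0 , s) down to (s , 0).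
unpair-pair : ∀ a b → unpair (pair a b) ≡ (a , b)
unpair-pair a b = along a b (start (a + b))
  where
  along : ∀ a b → unpair (pair 0 (a + b)) ≡ (0 , a + b) → unpair (pair a b) ≡ (a , b)
  start : ∀ s → unpair (pair 0 s) ≡ (0 , s)
  along zero    b e = e
  along (suc a) b e rewrite pair-sucˡ a b | unpair-suc (pair a (suc b))
    | along a (suc b) (subst (λ s → unpair (pair 0 s) ≡ (0 , s)) (sym (+-suc a b)) e) = refl
  start zero    = refl
  start (suc s) rewrite pair-zero-suc s | unpair-suc (pair s 0)
    | along s 0 (subst (λ t → unpair (pair 0 t) ≡ (0 , t)) (sym (+-identityʳ s)) (start s)) = refl

-- unpair by primitive recursion: the diagonal a + b of unpair n grows exactly when n reaches
-- the next triangular number.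
diagonal : ℕ → ℕ
diagonal zero    = 0
diagonal (suc n) = diagonal n + notᵗ ∣ triangle (suc (diagonal n)) - suc n ∣

diagonal≡ : ∀ n → diagonal n ≡ uncurry _+_ (unpair n)
diagonal≡ zero    = refl
diagonal≡ (suc n) rewrite unpair-suc n | diagonal≡ n = next (unpair n) (pair-unpair n)
  where
  next : ∀ p → uncurry pair p ≡ n →
    uncurry _+_ p + notᵗ ∣ triangle (suc (uncurry _+_ p)) - suc n ∣ ≡ uncurry _+_ (unpair-step p)
  next (a , zero) e rewrite sym e | +-identityʳ a | sym (+-suc (triangle a) a) | ∣n-n∣≡0 (triangle a + suc a) =
    +-comm a 1
  next (a , suc b) e rewrite sym e =
    trans (cong (_+_ (a + suc b)) (Equivalence.from (notᵗ≡0⇔≢0 _) (off-diagonal ∘ ∣m-n∣≡0⇒m≡n)))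
          (trans (+-identityʳ _) (+-suc a b))
    where
    off-diagonal : triangle (suc (a + suc b)) ≢ suc (triangle (a + suc b) + a)
    off-diagonal h = m+1+n≢m a (suc-injective (+-cancelˡ-≡ (triangle (a + suc b)) _ _ (trans h (sym (+-suc _ a)))))

unpair₁ : ℕ → ℕ
unpair₁ n = n ∸ triangle (diagonal n)

unpair₂ : ℕ → ℕ
unpair₂ n = diagonal n ∸ unpair₁ n

unpair₁≡ : ∀ n → unpair₁ n ≡ proj₁ (unpair n)
unpair₁≡ n = begin
  n ∸ triangle (diagonal n)          ≡⟨ cong₂ _∸_ (sym (pair-unpair n)) (cong triangle (diagonal≡ n)) ⟩
  triangle (a + b) + a ∸ triangle (a + b) ≡⟨ m+n∸m≡n (triangle (a + b)) a ⟩
  a                                  ∎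
  where
  open ≡-Reasoning
  a = proj₁ (unpair n)
  b = proj₂ (unpair n)

unpair₂≡ : ∀ n → unpair₂ n ≡ proj₂ (unpair n)
unpair₂≡ n rewrite unpair₁≡ n | diagonal≡ n = m+n∸m≡n (proj₁ (unpair n)) _

unpair₁-pair : ∀ a b → unpair₁ (pair a b) ≡ a
unpair₁-pair a b = trans (unpair₁≡ (pair a b)) (cong proj₁ (unpair-pair a b))

unpair₂-pair : ∀ a b → unpair₂ (pair a b) ≡ b
unpair₂-pair a b = trans (unpair₂≡ (pair a b)) (cong proj₂ (unpair-pair a b))

triangle-mono : ∀ {s t} → s ≤ t → triangle s ≤ triangle t
triangle-mono {zero}  _         = z≤n
triangle-mono {suc s} (s≤s s≤t) = +-mono-≤ (triangle-mono s≤t) (s≤s s≤t)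

pair-mono : ∀ {a b c d} → a ≤ c → b ≤ d → pair a b ≤ pair c d
pair-mono a≤c b≤d = +-mono-≤ (triangle-mono (+-mono-≤ a≤c b≤d)) a≤c

∣+m-+n∣≡∣m-n∣ : ∀ m n → ℤ.∣ + m ℤ.- + n ∣ ≡ ∣ m - n ∣
∣+m-+n∣≡∣m-n∣ m n rewrite ℤ.m-n≡m⊖n m n with ≤-total m n
... | inj₁ m≤n = trans (ℤ.∣⊖∣-≤ m≤n) (sym (m≤n⇒∣m-n∣≡n∸m m≤n))
... | inj₂ n≤m = trans (ℤ.∣m⊖n∣≡∣n⊖m∣ m n) (trans (ℤ.∣⊖∣-≤ n≤m) (trans (sym (m≤n⇒∣m-n∣≡n∸m n≤m)) (∣-∣-comm n m)))

∣-[1+m]-+n∣≡1+m+n : ∀ m n → ℤ.∣ -[1+ m ] ℤ.- + n ∣ ≡ suc m + n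
∣-[1+m]-+n∣≡1+m+n m zero    = cong suc (sym (+-identityʳ m))
∣-[1+m]-+n∣≡1+m+n m (suc n) = cong suc (sym (+-suc m n))

distℤ : ℕ → ℕ → ℕ
distℤ c r = if0 unpair₁ c then ∣ unpair₂ c - r ∣ else (suc (unpair₂ c) + r)

distℤ≡ : ∀ c r → distℤ c r ≡ ℤ.∣ decodeℤ c ℤ.- + r ∣
distℤ≡ c r rewrite unpair₂≡ c | unpair₁≡ c with unpair c
... | zero  , m = sym (∣+m-+n∣≡∣m-n∣ m r)
... | suc _ , m = sym (∣-[1+m]-+n∣≡1+m+n m r)

-- x % P by counting, which is a primitive recursion.
rem : ℕ → ℕ → ℕ
rem zero    P = 0
rem (suc x) P = if0 ∣ suc (rem x P) - P ∣ then 0 else suc (rem x P)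

rem≡% : ∀ P .{{_ : ℕ.NonZero P}} x → rem x P ≡ x % P
rem≡% (suc _) zero = refl
rem≡% P (suc x) rewrite rem≡% P x = sym (begin
  suc x % P                         ≡⟨ %-congˡ (cong suc (m≡m%n+[m/n]*n x P)) ⟩
  (suc (x % P) + (x / P) * P) % P   ≡⟨ [m+kn]%n≡m%n (suc (x % P)) (x / P) P ⟩
  suc (x % P) % P                   ≡⟨ wrap (m%n<n x P) ⟩
  if0 ∣ suc (x % P) - P ∣ then 0 else suc (x % P) ∎)
  where
  open ≡-Reasoning
  wrap : ∀ {r} → r < P → suc r % P ≡ if0 ∣ suc r - P ∣ then 0 else suc r
  wrap {r} r<P with ∣ suc r - P ∣ in eq
  ... | zero  = subst (λ m → m % P ≡ 0) (sym (∣m-n∣≡0⇒m≡n eq)) (n%n≡0 P)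
  ... | suc _ = m<n⇒m%n≡m (≤∧≢⇒< r<P (λ { refl → 0≢1+n (trans (sym (∣n-n∣≡0 (suc r))) eq) }))

period : ℕ → ℕ
period n = 2 ^ suc n

period≢0 : ∀ n → ℕ.NonZero (period n)
period≢0 n = m^n≢0 2 (suc n)

InLevel⇔∣ : ∀ r n i → InLevel (λ _ → + r) n i ⇔ period n ∣ ℤ.∣ i ℤ.- + r ∣
InLevel⇔∣ r n i = mk⇔
  (λ (z , i≡) → ℤ∣.∣⇒∣ᵤ (ℤ∣.divides z (trans (cong (ℤ._- + r) i≡) (cancel z (+ period n) (+ r)))))
  (λ p∣ → let ℤ∣.divides q e = ℤ∣.∣ᵤ⇒∣ {+ period n} {i ℤ.- + r} p∣ in
          q , trans (uncancel i (+ r)) (cong (ℤ._+ + r) e))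
  where
  cancel : ∀ a b c → a ℤ.* b ℤ.+ c ℤ.- c ≡ a ℤ.* b
  cancel = solve-∀
  uncancel : ∀ a c → a ≡ a ℤ.- c ℤ.+ c
  uncancel = solve-∀

χ-level : ℕ → ℕ → ℕ → ℕ
χ-level c n r = rem (distℤ c r) (period n)

χ-level≡0⇔ : ∀ c n r → χ-level c n r ≡ 0 ⇔ InLevel (λ _ → + r) n (decodeℤ c)
χ-level≡0⇔ c n r = begin
  rem (distℤ c r) (period n) ≡ 0      ≡⟨ cong (_≡ 0) (rem≡% (period n) (distℤ c r)) ⟩
  distℤ c r % period n ≡ 0            ≈⟨ m%n≡0⇔n∣m (distℤ c r) (period n) ⟩
  period n ∣ distℤ c r                ≡⟨ cong (period n ∣_) (distℤ≡ c r) ⟩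
  period n ∣ ℤ.∣ decodeℤ c ℤ.- + r ∣   ≈⟨ ⇔.sym (InLevel⇔∣ r n (decodeℤ c)) ⟩
  InLevel (λ _ → + r) n (decodeℤ c)    ∎
  where
  open ⇔-Reasoning
  instance _ = period≢0 n

level-residue : ∀ (kk : ℕ → ℤ) n → ∃ λ r → r < period n × (∀ i → InLevel kk n i ⇔ InLevel (λ _ → + r) n i)
level-residue kk n = r , n%ℕd<d (kk n) (period n) , λ i → mk⇔
  (λ (z , i≡) → z ℤ.+ q , trans i≡ (trans (cong (ℤ._+_ (z ℤ.* + period n)) kk≡) (shift-in z q (+ period n) (+ r))))
  (λ (z , i≡) → z ℤ.- q , trans i≡ (trans (shift-out z q (+ period n) (+ r)) (cong (ℤ._+_ ((z ℤ.- q) ℤ.* + period n)) (sym kk≡))))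
  where
  instance _ = period≢0 n
  r = kk n %ℕ period n
  q = kk n /ℕ period n
  kk≡ : kk n ≡ + r ℤ.+ q ℤ.* + period n
  kk≡ = a≡a%ℕn+[a/ℕn]*n (kk n) (period n)
  shift-in : ∀ a b c d → a ℤ.* c ℤ.+ (d ℤ.+ b ℤ.* c) ≡ (a ℤ.+ b) ℤ.* c ℤ.+ d
  shift-in = solve-∀
  shift-out : ∀ a b c d → a ℤ.* c ℤ.+ d ≡ (a ℤ.- b) ℤ.* c ℤ.+ (d ℤ.+ b ℤ.* c)
  shift-out = solve-∀

tailⁿ : ℕ → ℕ → ℕ
tailⁿ zero    e = e
tailⁿ (suc j) e = unpair₂ (tailⁿ j e)

entry : ℕ → ℕ → ℕ
entry e j = unpair₁ (tailⁿ j e)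

tailⁿ-suc : ∀ j e → tailⁿ (suc j) e ≡ tailⁿ j (unpair₂ e)
tailⁿ-suc zero    e = refl
tailⁿ-suc (suc j) e = cong unpair₂ (tailⁿ-suc j e)

entry-suc : ∀ e j → entry e (suc j) ≡ entry (unpair₂ e) j
entry-suc e j = cong unpair₁ (tailⁿ-suc j e)

All-decodeListN⇔ : ∀ {P : ℕ × ℕ → Set} l e → All P (decodeListN l e) ⇔ All< l (λ j → P (unpair (entry e j)))
All-decodeListN⇔ {P} l e = mk⇔ (to l e) (from l e)
  where
  to : ∀ l e → All P (decodeListN l e) → All< l (λ j → P (unpair (entry e j)))
  to (suc l) e (p ∷ ps) zero    _         rewrite unpair₁≡ e = p
  to (suc l) e (p ∷ ps) (suc j) (s≤s j<l) rewrite entry-suc e j | unpair₂≡ e = to l _ ps j j<l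
  from : ∀ l e → All< l (λ j → P (unpair (entry e j))) → All P (decodeListN l e)
  from zero    e h = []
  from (suc l) e h = subst (P ∘ unpair) (unpair₁≡ e) (h 0 z<s)
    ∷ from l _ (λ j j<l → subst (λ e′ → P (unpair (entry e′ j))) (unpair₂≡ e)
                            (subst (P ∘ unpair) (entry-suc e j) (h (suc j) (s≤s j<l))))

encode : ℕ → (ℕ → ℕ) → ℕ
encode zero    a = 0
encode (suc l) a = pair (a 0) (encode l (a ∘ suc))

entry-encode : ∀ l a j → j < l → entry (encode l a) j ≡ a j
entry-encode (suc l) a zero    _         = unpair₁-pair _ _
entry-encode (suc l) a (suc j) (s≤s j<l) rewrite entry-suc (encode (suc l) a) j | unpair₂-pair (a 0) (encode l (a ∘ suc)) =
  entry-encode l (a ∘ suc) j j<l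

encode-mono : ∀ l {a b} → (∀ j → j < l → a j ≤ b j) → encode l a ≤ encode l b
encode-mono zero    h = z≤n
encode-mono (suc l) h = pair-mono (h 0 z<s) (encode-mono l (λ j j<l → h (suc j) (s≤s j<l)))

wordPattern : ℕ → (ℕ → ℕ) → List (ℕ × ℕ)
wordPattern N X = applyDownFrom (λ c → c , X c) N

-- Listing the positions downwards makes wordEntries a primitive recursion in N.
wordEntries : ℕ → ℕ → ℕ
wordEntries zero    w = 0
wordEntries (suc N) w = pair (pair N (entry w N)) (wordEntries N w)

wordCode : ℕ → ℕ → ℕ
wordCode N w = pair N (wordEntries N w)

decodeList-wordCode : ∀ N w → decodeList (wordCode N w) ≡ wordPattern N (entry w)
decodeList-wordCode N w rewrite unpair-pair N (wordEntries N w) = go N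
  where
  go : ∀ N → decodeListN N (wordEntries N w) ≡ wordPattern N (entry w)
  go zero = refl
  go (suc N) rewrite unpair-pair (pair N (entry w N)) (wordEntries N w) | unpair-pair N (entry w N) =
    cong ((N , entry w N) ∷_) (go N)

letters : ∀ {k} → Conf k → ℕ → ℕ
letters x c = toℕ (x (decodeℤ c))

inCyl-wordPattern⇔ : ∀ {k} (x : Conf k) N X → inCylℤ x (mapPos (wordPattern N X)) ⇔ Agree N (letters x) X
inCyl-wordPattern⇔ x N X = mk⇔ (to N) (from N)
  where
  to : ∀ N → inCylℤ x (mapPos (wordPattern N X)) → Agree N (letters x) X
  to (suc N) (p ∷ ps) c c<1+N with m≤n⇒m<n∨m≡n (s≤s⁻¹ c<1+N)
  ... | inj₁ c<N  = to N ps c c<N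
  ... | inj₂ refl = p
  from : ∀ N → Agree N (letters x) X → inCylℤ x (mapPos (wordPattern N X))
  from zero    h = []
  from (suc N) h = h N ≤-refl ∷ from N (λ c c<N → h c (m<n⇒m<1+n c<N))

inCyl-wordCode⇔ : ∀ {k} (x : Conf k) N w → inCylℤ x (decodePatℤ (wordCode N w)) ⇔ Agree N (letters x) (entry w)
inCyl-wordCode⇔ x N w = subst (λ l → inCylℤ x (mapPos l) ⇔ Agree N (letters x) (entry w))
                          (sym (decodeList-wordCode N w)) (inCyl-wordPattern⇔ x N (entry w))

emptyCode : ℕ → ℕ
emptyCode k = pair 1 (pair (pair 0 k) 0)

-- The pattern of emptyCode k asks for the letter k, which is outside Fin k.
emptyCode-empty : ∀ {k} (x : Conf k) → ¬ inCylℤ x (decodePatℤ (emptyCode k))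
emptyCode-empty {k} x x∈ rewrite unpair-pair 1 (pair (pair 0 k) 0) | unpair-pair (pair 0 k) 0 | unpair-pair 0 k
  with x∈
... | x₀≡k ∷ [] = <-irrefl x₀≡k (toℕ<n _)

encodeℤ : ℤ → ℕ
encodeℤ (+ m)    = pair 0 m
encodeℤ -[1+ m ] = pair 1 m

decodeℤ-encodeℤ : ∀ i → decodeℤ (encodeℤ i) ≡ i
decodeℤ-encodeℤ (+ m)    rewrite unpair-pair 0 m = refl
decodeℤ-encodeℤ -[1+ m ] rewrite unpair-pair 1 m = refl

positions-bounded : ∀ (l : List (ℕ × ℕ)) → ∃ λ N → All (λ q → proj₁ q < N) l
positions-bounded []            = 0 , []
positions-bounded ((i , _) ∷ l) =
  let (N , below) = positions-bounded l in
  suc i ⊔ N , m≤m⊔n (suc i) N ∷ All.map (λ i<N → <-≤-trans i<N (m≤n⊔m (suc i) N)) below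

wordOf : ∀ {k} → Conf k → ℕ → ℕ
wordOf x N = encode N (letters x)

≤-lift : ∀ {P : ℕ → Set} → (∀ {n} → P n → P (suc n)) → ∀ {m n} → m ≤ n → P m → P n
≤-lift {P} step {m} m≤n p = go (≤⇒≤′ m≤n)
  where
  go : ∀ {n} → m ℕ.≤′ n → P n
  go ℕ.≤′-refl       = p
  go (ℕ.≤′-step m≤n) = step (go m≤n)

mutual
  eval-suc : ∀ {n} k (c : Code n) v r → eval k c v ≡ just r → eval (suc k) c v ≡ just r
  eval-suc (suc k) zeroC     v        r e = e
  eval-suc (suc k) succC     (x ∷ []) r e = e
  eval-suc (suc k) (projC i) v        r e = e
  eval-suc (suc k) (compC f gs) v r e with evalVec k gs v in eq
  ... | just ws rewrite evalVec-suc k gs v ws eq = eval-suc k f ws r e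
  eval-suc (suc k) (recC f g) (x ∷ v) r e = recLoop-suc k f g x v r e
  eval-suc (suc k) (muC f)    v       r e = muLoop-suc k f v 0 r e

  evalVec-suc : ∀ {m n} k (gs : Vec (Code n) m) v ws →
    evalVec k gs v ≡ just ws → evalVec (suc k) gs v ≡ just ws
  evalVec-suc k []       v ws e = e
  evalVec-suc k (g ∷ gs) v ws e with eval k g v in eq₁
  ... | just w with evalVec k gs v in eq₂
  ... | just ws′ rewrite eval-suc k g v w eq₁ | evalVec-suc k gs v ws′ eq₂ = e

  recLoop-suc : ∀ {n} k (f : Code n) g x v r →
    recLoop k f g x v ≡ just r → recLoop (suc k) f g x v ≡ just r
  recLoop-suc k f g zero    v r e = eval-suc k f v r e
  recLoop-suc k f g (suc x) v r e with recLoop k f g x v in eq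
  ... | just r′ rewrite recLoop-suc k f g x v r′ eq = eval-suc k g _ r e

  muLoop-suc : ∀ {n} k (f : Code (suc n)) v i r →
    muLoop k f v i ≡ just r → muLoop (suc k) f v i ≡ just r
  muLoop-suc (suc k) f v i r e with eval k f (i ∷ v) in eq
  ... | just zero    rewrite eval-suc k f (i ∷ v) 0 eq = e
  ... | just (suc y) rewrite eval-suc k f (i ∷ v) (suc y) eq = muLoop-suc k f v (suc i) r e

eval-mono : ∀ {n k k′} (c : Code n) {v r} → k ≤ k′ → eval k c v ≡ just r → eval k′ c v ≡ just r
eval-mono c {v} {r} = ≤-lift {λ k → eval k c v ≡ just r} (eval-suc _ c v r)

evalVec-mono : ∀ {m n k k′} (gs : Vec (Code n) m) {v ws} →
  k ≤ k′ → evalVec k gs v ≡ just ws → evalVec k′ gs v ≡ just ws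
evalVec-mono gs {v} {ws} = ≤-lift {λ k → evalVec k gs v ≡ just ws} (evalVec-suc _ gs v ws)

recLoop-mono : ∀ {n k k′} (f : Code n) g x {v r} →
  k ≤ k′ → recLoop k f g x v ≡ just r → recLoop k′ f g x v ≡ just r
recLoop-mono f g x {v} {r} = ≤-lift {λ k → recLoop k f g x v ≡ just r} (recLoop-suc _ f g x v r)

data PR : ℕ → Set where
  zero′  : ∀ {n} → PR n
  succ′  : PR 1
  proj′  : ∀ {n} → Fin n → PR n
  comp′  : ∀ {m n} → PR m → Vec (PR n) m → PR n
  rec′   : ∀ {n} → PR n → PR (suc (suc n)) → PR (suc n)
  oracle : PR 1

module Relative (g : ℕ → ℕ) where

  mutual
    ⟦_⟧ : ∀ {n} → PR n → Vec ℕ n → ℕ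
    ⟦ zero′     ⟧ v        = 0
    ⟦ succ′     ⟧ (x ∷ []) = suc x
    ⟦ proj′ i   ⟧ v        = lookup v i
    ⟦ comp′ f hs ⟧ v       = ⟦ f ⟧ (⟦ hs ⟧* v)
    ⟦ rec′ f h  ⟧ (x ∷ v)  = ⟦ f , h ⟧rec x v
    ⟦ oracle    ⟧ (x ∷ []) = g x

    ⟦_⟧* : ∀ {m n} → Vec (PR n) m → Vec ℕ n → Vec ℕ m
    ⟦ []     ⟧* v = []
    ⟦ f ∷ fs ⟧* v = ⟦ f ⟧ v ∷ ⟦ fs ⟧* v

    ⟦_,_⟧rec : ∀ {n} → PR n → PR (suc (suc n)) → ℕ → Vec ℕ n → ℕ
    ⟦ f , h ⟧rec zero    v = ⟦ f ⟧ v
    ⟦ f , h ⟧rec (suc x) v = ⟦ h ⟧ (x ∷ ⟦ f , h ⟧rec x v ∷ v)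

  Definable : ∀ n → (Vec ℕ n → ℕ) → Set
  Definable n f = Σ (PR n) λ c → ∀ v → ⟦ c ⟧ v ≡ f v

  respᴾ : ∀ {n} {f f′ : Vec ℕ n → ℕ} → Definable n f → (∀ v → f v ≡ f′ v) → Definable n f′
  respᴾ (c , c≡f) f≡f′ = c , λ v → trans (c≡f v) (f≡f′ v)

  zeroᴾ : ∀ {n} → Definable n (λ _ → 0)
  zeroᴾ = zero′ , λ v → refl

  succᴾ : Definable 1 (suc $ⁿ_)
  succᴾ = succ′ , λ { (x ∷ []) → refl }

  projᴾ : ∀ {n} (i : Fin n) → Definable n (λ v → lookup v i)
  projᴾ i = proj′ i , λ v → refl

  oracleᴾ : Definable 1 (g $ⁿ_)
  oracleᴾ = oracle , λ { (x ∷ []) → refl }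

  π₀ : ∀ {n} → Definable (suc n) (λ v → lookup v fzero)
  π₀ = projᴾ fzero
  π₁ : ∀ {n} → Definable (2 + n) (λ v → lookup v (fsuc fzero))
  π₁ = projᴾ (fsuc fzero)
  π₂ : ∀ {n} → Definable (3 + n) (λ v → lookup v (fsuc (fsuc fzero)))
  π₂ = projᴾ (fsuc (fsuc fzero))
  π₃ : ∀ {n} → Definable (4 + n) (λ v → lookup v (fsuc (fsuc (fsuc fzero))))
  π₃ = projᴾ (fsuc (fsuc (fsuc fzero)))
  π₄ : ∀ {n} → Definable (5 + n) (λ v → lookup v (fsuc (fsuc (fsuc (fsuc fzero)))))
  π₄ = projᴾ (fsuc (fsuc (fsuc (fsuc fzero))))

  comp₁ : ∀ {n} {f : Vec ℕ 1 → ℕ} {h₁ : Vec ℕ n → ℕ} →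
    Definable 1 f → Definable n h₁ → Definable n (λ v → f (h₁ v ∷ []))
  comp₁ {f = f} (cf , ef) (c₁ , e₁) = comp′ cf (c₁ ∷ []) , λ v → trans (ef _) (cong (λ y → f (y ∷ [])) (e₁ v))

  comp₂ : ∀ {n} {f : Vec ℕ 2 → ℕ} {h₁ h₂ : Vec ℕ n → ℕ} →
    Definable 2 f → Definable n h₁ → Definable n h₂ → Definable n (λ v → f (h₁ v ∷ h₂ v ∷ []))
  comp₂ {f = f} (cf , ef) (c₁ , e₁) (c₂ , e₂) = comp′ cf (c₁ ∷ c₂ ∷ []) ,
    λ v → trans (ef _) (cong₂ (λ y z → f (y ∷ z ∷ [])) (e₁ v) (e₂ v))

  comp₃ : ∀ {n} {f : Vec ℕ 3 → ℕ} {h₁ h₂ h₃ : Vec ℕ n → ℕ} →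
    Definable 3 f → Definable n h₁ → Definable n h₂ → Definable n h₃ →
    Definable n (λ v → f (h₁ v ∷ h₂ v ∷ h₃ v ∷ []))
  comp₃ {f = f} (cf , ef) (c₁ , e₁) (c₂ , e₂) (c₃ , e₃) = comp′ cf (c₁ ∷ c₂ ∷ c₃ ∷ []) ,
    λ v → trans (ef _) (trans (cong₂ (λ y z → f (y ∷ z ∷ _ ∷ [])) (e₁ v) (e₂ v))
                              (cong (λ y → f (_ ∷ _ ∷ y ∷ [])) (e₃ v)))

  comp₄ : ∀ {n} {f : Vec ℕ 4 → ℕ} {h₁ h₂ h₃ h₄ : Vec ℕ n → ℕ} →
    Definable 4 f → Definable n h₁ → Definable n h₂ → Definable n h₃ → Definable n h₄ →
    Definable n (λ v → f (h₁ v ∷ h₂ v ∷ h₃ v ∷ h₄ v ∷ []))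
  comp₄ {f = f} (cf , ef) (c₁ , e₁) (c₂ , e₂) (c₃ , e₃) (c₄ , e₄) = comp′ cf (c₁ ∷ c₂ ∷ c₃ ∷ c₄ ∷ []) ,
    λ v → trans (ef _) (trans (cong₂ (λ y z → f (y ∷ z ∷ _ ∷ _ ∷ [])) (e₁ v) (e₂ v))
                              (cong₂ (λ y z → f (_ ∷ _ ∷ y ∷ z ∷ [])) (e₃ v) (e₄ v)))

  comp₅ : ∀ {n} {f : Vec ℕ 5 → ℕ} {h₁ h₂ h₃ h₄ h₅ : Vec ℕ n → ℕ} →
    Definable 5 f → Definable n h₁ → Definable n h₂ → Definable n h₃ → Definable n h₄ → Definable n h₅ →
    Definable n (λ v → f (h₁ v ∷ h₂ v ∷ h₃ v ∷ h₄ v ∷ h₅ v ∷ []))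
  comp₅ {f = f} (cf , ef) (c₁ , e₁) (c₂ , e₂) (c₃ , e₃) (c₄ , e₄) (c₅ , e₅) =
    comp′ cf (c₁ ∷ c₂ ∷ c₃ ∷ c₄ ∷ c₅ ∷ []) ,
    λ v → trans (ef _) (trans (cong₂ (λ y z → f (y ∷ z ∷ _ ∷ _ ∷ _ ∷ [])) (e₁ v) (e₂ v))
                       (trans (cong₂ (λ y z → f (_ ∷ _ ∷ y ∷ z ∷ _ ∷ [])) (e₃ v) (e₄ v))
                              (cong (λ y → f (_ ∷ _ ∷ _ ∷ _ ∷ y ∷ [])) (e₅ v))))

  recᴾ : ∀ {n} {f : Vec ℕ n → ℕ} {h : Vec ℕ (2 + n) → ℕ} (F : ℕ → Vec ℕ n → ℕ) →
    Definable n f → Definable (2 + n) h →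
    (∀ v → F 0 v ≡ f v) → (∀ x v → F (suc x) v ≡ h (x ∷ F x v ∷ v)) →
    Definable (suc n) (λ v → F (head v) (tail v))
  recᴾ {n} {f} {h} F (cf , ef) (ch , eh) F0 Fsuc = rec′ cf ch , λ { (x ∷ v) → go x v }
    where
    go : ∀ x v → ⟦ cf , ch ⟧rec x v ≡ F x v
    go zero    v = trans (ef v) (sym (F0 v))
    go (suc x) v = trans (eh _) (trans (cong (λ y → h (x ∷ y ∷ v)) (go x v)) (sym (Fsuc x v)))

  skip₁ᴾ : ∀ {n} {f : Vec ℕ (suc n) → ℕ} → Definable (suc n) f →
    Definable (2 + n) (λ v → f (head v ∷ tail (tail v)))
  skip₁ᴾ {n} {f} (c , e) = comp′ c (proj′ fzero ∷ tabulate (proj′ ∘ fsuc ∘ fsuc)) ,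
    λ { (x ∷ y ∷ v) → trans (e _) (cong (λ u → f (x ∷ u)) (trans (projections (fsuc ∘ fsuc) (x ∷ y ∷ v)) (tabulate∘lookup v))) }
    where
    projections : ∀ {m} (σ : Fin m → Fin (2 + n)) v → ⟦ tabulate (proj′ ∘ σ) ⟧* v ≡ tabulate (lookup v ∘ σ)
    projections {zero}  σ v = refl
    projections {suc m} σ v = cong (lookup v (σ fzero) ∷_) (projections (σ ∘ fsuc) v)

  constᴾ : ∀ {n} m → Definable n (λ _ → m)
  constᴾ zero    = zeroᴾ
  constᴾ (suc m) = comp₁ succᴾ (constᴾ m)

  addᴾ : Definable 2 (_+_ $ⁿ_)
  addᴾ = respᴾ (recᴾ (λ x v → x + lookup v fzero) π₀ (comp₁ succᴾ π₁) (λ v → refl) (λ x v → refl))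
               (λ { (a ∷ b ∷ []) → refl })

  mulᴾ : Definable 2 (_*_ $ⁿ_)
  mulᴾ = respᴾ (recᴾ (λ x v → x * lookup v fzero) zeroᴾ (comp₂ addᴾ π₂ π₁) (λ v → refl) (λ x v → refl))
               (λ { (a ∷ b ∷ []) → refl })

  predᴾ : Definable 1 (ℕ.pred $ⁿ_)
  predᴾ = respᴾ (recᴾ (λ x v → ℕ.pred x) zeroᴾ π₀ (λ v → refl) (λ x v → refl))
                (λ { (a ∷ []) → refl })

  monusᴾ : Definable 2 (_∸_ $ⁿ_)
  monusᴾ = respᴾ (comp₂ flipped π₁ π₀) (λ { (a ∷ b ∷ []) → refl })
    where
    flipped : Definable 2 ((λ n m → m ∸ n) $ⁿ_)
    flipped = respᴾ (recᴾ (λ x v → lookup v fzero ∸ x) π₀ (comp₁ predᴾ π₁) (λ v → refl)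
                      (λ x v → sym (pred[m∸n]≡m∸[1+n] (lookup v fzero) x)))
                    (λ { (a ∷ b ∷ []) → refl })

  powᴾ : Definable 1 ((2 ^_) $ⁿ_)
  powᴾ = respᴾ (recᴾ (λ x v → 2 ^ x) (constᴾ 1) (comp₂ addᴾ π₁ π₁) (λ v → refl)
                  (λ x v → cong (_+_ (2 ^ x)) (+-identityʳ (2 ^ x))))
               (λ { (a ∷ []) → refl })

  if0ᴾ : Definable 3 (if0_then_else_ $ⁿ_)
  if0ᴾ = respᴾ (recᴾ (λ x v → if0 x then lookup v fzero else lookup v (fsuc fzero)) π₀ π₃ (λ v → refl) (λ x v → refl))
               (λ { (a ∷ b ∷ c ∷ []) → refl })

  distᴾ : Definable 2 (∣_-_∣ $ⁿ_)
  distᴾ = respᴾ (comp₂ addᴾ (comp₂ monusᴾ π₀ π₁) (comp₂ monusᴾ π₁ π₀))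
                (λ { (a ∷ b ∷ []) → sym (∣m-n∣≡m∸n+n∸m a b) })

  notᴾ : Definable 1 (notᵗ $ⁿ_)
  notᴾ = respᴾ (comp₂ monusᴾ (constᴾ 1) π₀) (λ { (a ∷ []) → refl })

  sum<ᴾ : ∀ {n} {f : Vec ℕ (suc n) → ℕ} → Definable (suc n) f →
    Definable (suc n) (λ v → sum< (head v) (λ j → f (j ∷ tail v)))
  sum<ᴾ {f = f} f-def = recᴾ (λ x v → sum< x (λ j → f (j ∷ v))) zeroᴾ (comp₂ addᴾ π₁ (skip₁ᴾ f-def))
                          (λ v → refl) (λ x v → refl)

  triangleᴾ : Definable 1 (triangle $ⁿ_)
  triangleᴾ = respᴾ (recᴾ (λ x v → triangle x) zeroᴾ (comp₂ addᴾ π₁ (comp₁ succᴾ π₀)) (λ v → refl) (λ x v → refl))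
                    (λ { (a ∷ []) → refl })

  pairᴾ : Definable 2 (pair $ⁿ_)
  pairᴾ = respᴾ (comp₂ addᴾ (comp₁ triangleᴾ (comp₂ addᴾ π₀ π₁)) π₀) (λ { (a ∷ b ∷ []) → refl })

  diagonalᴾ : Definable 1 (diagonal $ⁿ_)
  diagonalᴾ = respᴾ (recᴾ (λ x v → diagonal x) zeroᴾ
                       (comp₂ addᴾ π₁ (comp₁ notᴾ (comp₂ distᴾ (comp₁ triangleᴾ (comp₁ succᴾ π₁)) (comp₁ succᴾ π₀))))
                       (λ v → refl) (λ x v → refl))
                    (λ { (a ∷ []) → refl })

  unpair₁ᴾ : Definable 1 (unpair₁ $ⁿ_)
  unpair₁ᴾ = respᴾ (comp₂ monusᴾ π₀ (comp₁ triangleᴾ (comp₁ diagonalᴾ π₀))) (λ { (a ∷ []) → refl })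

  unpair₂ᴾ : Definable 1 (unpair₂ $ⁿ_)
  unpair₂ᴾ = respᴾ (comp₂ monusᴾ (comp₁ diagonalᴾ π₀) (comp₁ unpair₁ᴾ π₀)) (λ { (a ∷ []) → refl })

  tailⁿᴾ : Definable 2 (tailⁿ $ⁿ_)
  tailⁿᴾ = respᴾ (recᴾ (λ x v → tailⁿ x (lookup v fzero)) π₀ (comp₁ unpair₂ᴾ π₁) (λ { (e ∷ []) → refl }) (λ { x (e ∷ []) → refl }))
                 (λ { (a ∷ b ∷ []) → refl })

  entryᴾ : Definable 2 (entry $ⁿ_)
  entryᴾ = respᴾ (comp₁ unpair₁ᴾ (comp₂ tailⁿᴾ π₁ π₀)) (λ { (a ∷ b ∷ []) → refl })

  constEncodeᴾ : Definable 2 ((λ l M → encode l (λ _ → M)) $ⁿ_)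
  constEncodeᴾ = respᴾ (recᴾ (λ x v → encode x (λ _ → lookup v fzero)) zeroᴾ (comp₂ pairᴾ π₂ π₁)
                             (λ { (M ∷ []) → refl }) (λ { x (M ∷ []) → refl }))
                       (λ { (a ∷ b ∷ []) → refl })

  remᴾ : Definable 2 (rem $ⁿ_)
  remᴾ = respᴾ (recᴾ (λ x v → rem x (lookup v fzero)) zeroᴾ
                  (comp₃ if0ᴾ (comp₂ distᴾ (comp₁ succᴾ π₁) π₂) zeroᴾ (comp₁ succᴾ π₁))
                  (λ { (P ∷ []) → refl }) (λ { x (P ∷ []) → refl }))
               (λ { (a ∷ b ∷ []) → refl })

  periodᴾ : Definable 1 (period $ⁿ_)
  periodᴾ = respᴾ (comp₁ powᴾ (comp₁ succᴾ π₀)) (λ { (a ∷ []) → refl })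

  χ-levelᴾ : Definable 3 (χ-level $ⁿ_)
  χ-levelᴾ = respᴾ (comp₂ remᴾ distℤᴾ (comp₁ periodᴾ π₁)) (λ { (a ∷ b ∷ c ∷ []) → refl })
    where
    distℤᴾ : Definable 3 ((λ c n r → distℤ c r) $ⁿ_)
    distℤᴾ = respᴾ (comp₃ if0ᴾ (comp₁ unpair₁ᴾ π₀) (comp₂ distᴾ (comp₁ unpair₂ᴾ π₀) π₂)
                              (comp₂ addᴾ (comp₁ succᴾ (comp₁ unpair₂ᴾ π₀)) π₂))
                   (λ { (a ∷ b ∷ c ∷ []) → refl })

  wordCodeᴾ : Definable 2 (wordCode $ⁿ_)
  wordCodeᴾ = respᴾ (comp₂ pairᴾ π₀ (comp₂ wordEntriesᴾ π₀ π₁)) (λ { (a ∷ b ∷ []) → refl })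
    where
    wordEntriesᴾ : Definable 2 (wordEntries $ⁿ_)
    wordEntriesᴾ = respᴾ (recᴾ (λ x v → wordEntries x (lookup v fzero)) zeroᴾ
                            (comp₂ pairᴾ (comp₂ pairᴾ π₀ (comp₂ entryᴾ π₂ π₀)) π₁)
                            (λ { (w ∷ []) → refl }) (λ { x (w ∷ []) → refl }))
                         (λ { (a ∷ b ∷ []) → refl })

module _ (cg : Code 1) where

  mutual
    compile : ∀ {n} → PR n → Code n
    compile zero′        = zeroC
    compile succ′        = succC
    compile (proj′ i)    = projC i
    compile (comp′ f hs) = compC (compile f) (compile* hs)
    compile (rec′ f h)   = recC (compile f) (compile h)
    compile oracle       = cg

    compile* : ∀ {m n} → Vec (PR n) m → Vec (Code n) m
    compile* []       = []
    compile* (f ∷ fs) = compile f ∷ compile* fs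

module _ {g : ℕ → ℕ} {cg : Code 1} (cg-computes : ∀ n → ∃ λ k → eval k cg (n ∷ []) ≡ just (g n)) where
  open Relative g

  mutual
    compile-correct : ∀ {n} (c : PR n) v → ∃ λ k → eval k (compile cg c) v ≡ just (⟦ c ⟧ v)
    compile-correct zero′     v        = 1 , refl
    compile-correct succ′     (x ∷ []) = 1 , refl
    compile-correct (proj′ i) v        = 1 , refl
    compile-correct (comp′ f hs) v with compile-correct* hs v | compile-correct f (⟦ hs ⟧* v)
    ... | k₁ , e₁ | k₂ , e₂ = suc (k₁ ⊔ k₂) ,
      trans (cong (_>>= _) (evalVec-mono (compile* cg hs) (m≤m⊔n k₁ k₂) e₁))
            (eval-mono (compile cg f) (m≤n⊔m k₁ k₂) e₂)
    compile-correct (rec′ f h) (x ∷ v) with compile-correct-rec f h x v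
    ... | k , e = suc k , e
    compile-correct oracle (x ∷ []) = cg-computes x

    compile-correct* : ∀ {m n} (fs : Vec (PR n) m) v →
      ∃ λ k → evalVec k (compile* cg fs) v ≡ just (⟦ fs ⟧* v)
    compile-correct* []       v = 0 , refl
    compile-correct* (f ∷ fs) v with compile-correct f v | compile-correct* fs v
    ... | k₁ , e₁ | k₂ , e₂ = k₁ ⊔ k₂ ,
      trans (cong (_>>= _) (eval-mono (compile cg f) (m≤m⊔n k₁ k₂) e₁))
            (cong (_>>= _) (evalVec-mono (compile* cg fs) (m≤n⊔m k₁ k₂) e₂))

    compile-correct-rec : ∀ {n} (f : PR n) h x v →
      ∃ λ k → recLoop k (compile cg f) (compile cg h) x v ≡ just (⟦ f , h ⟧rec x v)
    compile-correct-rec f h zero    v = compile-correct f v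
    compile-correct-rec f h (suc x) v with compile-correct-rec f h x v | compile-correct h (x ∷ ⟦ f , h ⟧rec x v ∷ v)
    ... | k₁ , e₁ | k₂ , e₂ = k₁ ⊔ k₂ ,
      trans (cong (_>>= _) (recLoop-mono (compile cg f) (compile cg h) x (m≤m⊔n k₁ k₂) e₁))
            (eval-mono (compile cg h) (m≤n⊔m k₁ k₂) e₂)

Definable⇒Computable : ∀ {g f : ℕ → ℕ} → Computable g → Relative.Definable g 1 (f $ⁿ_) → Computable f
Definable⇒Computable {g} (cg , cg-computes) (c , c-computes) = compile cg c , λ n →
  let (k , e) = compile-correct cg-computes c (n ∷ []) in k , trans e (cong just (c-computes (n ∷ [])))

OnLevel : (ℕ → ℕ) → ℕ → ℕ → Set
OnLevel r n c = InLevel (+_ ∘ r) n (decodeℤ c)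

module Approximation (k : ℕ) (g : ℕ → ℕ) where

  Matches : ℕ → (ℕ → ℕ) → ℕ × ℕ → Set
  Matches N a q = proj₁ q < N × a (proj₁ q) ≡ proj₂ q

  Covers : ℕ → (ℕ → ℕ) → ℕ → Set
  Covers N a p = All (Matches N a) (decodePatℕ p)

  -- A depth-N approximation of a point x of 𝒟_S: letters a n and offsets r n of the first N
  -- levels, checked against the letters X c of x at the positions decodeℤ c with c < N.
  record Approx (N : ℕ) (X a r : ℕ → ℕ) : Set where
    field
      bounded    : All< N λ n → a n < k × r n < period n
      disjoint   : All< N λ c → All< N λ m → All< N λ n → OnLevel r m c × OnLevel r n c → m ≡ n
      consistent : All< N λ c → All< N λ n → OnLevel r n c → X c ≡ a n
      avoids     : All< N λ t → ¬ Covers N a (g t)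

  Covers-mono : ∀ {M N a} p → M ≤ N → Covers M a p → Covers N a p
  Covers-mono p M≤N = All.map (λ (i<M , e) → <-≤-trans i<M M≤N , e)

  Covers-cong : ∀ {N a a′} p → Agree N a a′ → Covers N a′ p → Covers N a p
  Covers-cong p a≗a′ = All.map (λ (i<N , e) → i<N , trans (a≗a′ _ i<N) e)

  Approx-mono : ∀ {M N X a r} → M ≤ N → Approx N X a r → Approx M X a r
  Approx-mono M≤N A = record
    { bounded    = λ n n<M → bounded n (below n<M)
    ; disjoint   = λ c c<M m m<M n n<M → disjoint c (below c<M) m (below m<M) n (below n<M)
    ; consistent = λ c c<M n n<M → consistent c (below c<M) n (below n<M)
    ; avoids     = λ t t<M covers → avoids t (below t<M) (Covers-mono (g t) M≤N covers)
    }
    where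
    open Approx A
    below : ∀ {j} → j < _ → j < _
    below j<M = <-≤-trans j<M M≤N

  Approx-cong : ∀ {N X a r X′ a′ r′} → Agree N X X′ → Agree N a a′ → Agree N r r′ →
    Approx N X a r → Approx N X′ a′ r′
  Approx-cong {r = r} {r′ = r′} X≗X′ a≗a′ r≗r′ A = record
    { bounded    = λ n n<N → subst (_< k) (a≗a′ n n<N) (proj₁ (bounded n n<N)) ,
                             subst (_< period n) (r≗r′ n n<N) (proj₂ (bounded n n<N))
    ; disjoint   = λ c c<N m m<N n n<N (on-m , on-n) →
                     disjoint c c<N m m<N n n<N (level c m<N on-m , level c n<N on-n)
    ; consistent = λ c c<N n n<N on-n →
                     trans (sym (X≗X′ c c<N)) (trans (consistent c c<N n n<N (level c n<N on-n)) (a≗a′ n n<N))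
    ; avoids     = λ t t<N covers → avoids t t<N (Covers-cong (g t) a≗a′ covers)
    }
    where
    open Approx A
    level : ∀ {n} c → n < _ → OnLevel r′ n c → OnLevel r n c
    level {n} c n<N = subst (λ s → InLevel (λ _ → + s) n (decodeℤ c)) (sym (r≗r′ n n<N))

  χ-entry : ℕ → ℕ → ℕ → ℕ
  χ-entry N ea q = (suc (unpair₁ q) ∸ N) + ∣ entry ea (unpair₁ q) - unpair₂ q ∣

  χ-covers : ℕ → ℕ → ℕ → ℕ
  χ-covers N ea p = sum< (unpair₁ p) (λ j → χ-entry N ea (entry (unpair₂ p) j))

  χ-bounded : ℕ → ℕ → ℕ → ℕ
  χ-bounded N ea er = sum< N λ n → (suc (entry ea n) ∸ k) + (suc (entry er n) ∸ period n)

  χ-disjoint : ℕ → ℕ → ℕ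
  χ-disjoint N er = sum< N λ c → sum< N λ m → sum< N λ n →
    notᵗ (χ-level c m (entry er m) + χ-level c n (entry er n)) * ∣ m - n ∣

  χ-consistent : ℕ → ℕ → ℕ → ℕ → ℕ
  χ-consistent N w ea er = sum< N λ c → sum< N λ n →
    notᵗ (χ-level c n (entry er n)) * ∣ entry w c - entry ea n ∣

  χ-avoids : ℕ → ℕ → ℕ
  χ-avoids N ea = sum< N λ t → notᵗ (χ-covers N ea (g t))

  χ-approx : ℕ → ℕ → ℕ → ℕ → ℕ
  χ-approx N w ea er = χ-bounded N ea er + χ-disjoint N er + χ-consistent N w ea er + χ-avoids N ea

  χ-entry≡0⇔ : ∀ N ea q → χ-entry N ea q ≡ 0 ⇔ Matches N (entry ea) (unpair q)
  χ-entry≡0⇔ N ea q rewrite unpair₂≡ q | unpair₁≡ q =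
    ⇔.trans (m+n≡0⇔ _ _) (1+m∸n≡0⇔m<n _ _ ×-⇔ ∣m-n∣≡0⇔m≡n _ _)

  χ-covers≡0⇔ : ∀ N ea p → χ-covers N ea p ≡ 0 ⇔ Covers N (entry ea) p
  χ-covers≡0⇔ N ea p = begin
    χ-covers N ea p ≡ 0                                          ≈⟨ sum<≡0⇔ _ _ ⟩
    All< (unpair₁ p) (λ j → χ-entry N ea (entry (unpair₂ p) j) ≡ 0)
                                   ≈⟨ All<-cong _ (λ j → χ-entry≡0⇔ N ea (entry (unpair₂ p) j)) ⟩
    All< (unpair₁ p) (λ j → Matches N (entry ea) (unpair (entry (unpair₂ p) j)))
                                   ≈⟨ ⇔.sym (All-decodeListN⇔ (unpair₁ p) (unpair₂ p)) ⟩
    All (Matches N (entry ea)) (decodeListN (unpair₁ p) (unpair₂ p))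
                                   ≡⟨ cong₂ (λ l e → All (Matches N (entry ea)) (decodeListN l e)) (unpair₁≡ p) (unpair₂≡ p) ⟩
    Covers N (entry ea) p          ∎
    where open ⇔-Reasoning

  χ-bounded≡0⇔ : ∀ N ea er → χ-bounded N ea er ≡ 0 ⇔ All< N λ n → entry ea n < k × entry er n < period n
  χ-bounded≡0⇔ N ea er = ⇔.trans (sum<≡0⇔ _ _) (All<-cong N λ n →
    ⇔.trans (m+n≡0⇔ _ _) (1+m∸n≡0⇔m<n _ _ ×-⇔ 1+m∸n≡0⇔m<n _ _))

  χ-disjoint≡0⇔ : ∀ N er → χ-disjoint N er ≡ 0 ⇔
    All< N λ c → All< N λ m → All< N λ n → OnLevel (entry er) m c × OnLevel (entry er) n c → m ≡ n
  χ-disjoint≡0⇔ N er = ⇔.trans (sum<≡0⇔ _ _) (All<-cong N λ c →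
    ⇔.trans (sum<≡0⇔ _ _) (All<-cong N λ m →
    ⇔.trans (sum<≡0⇔ _ _) (All<-cong N λ n →
    ⇔.trans (notᵗp*q≡0⇔ _ _)
      (→-cong-⇔ (⇔.trans (m+n≡0⇔ _ _) (χ-level≡0⇔ c m _ ×-⇔ χ-level≡0⇔ c n _)) (∣m-n∣≡0⇔m≡n m n)))))

  χ-consistent≡0⇔ : ∀ N w ea er → χ-consistent N w ea er ≡ 0 ⇔
    All< N λ c → All< N λ n → OnLevel (entry er) n c → entry w c ≡ entry ea n
  χ-consistent≡0⇔ N w ea er = ⇔.trans (sum<≡0⇔ _ _) (All<-cong N λ c →
    ⇔.trans (sum<≡0⇔ _ _) (All<-cong N λ n →
    ⇔.trans (notᵗp*q≡0⇔ _ _) (→-cong-⇔ (χ-level≡0⇔ c n _) (∣m-n∣≡0⇔m≡n _ _))))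

  χ-avoids≡0⇔ : ∀ N ea → χ-avoids N ea ≡ 0 ⇔ All< N λ t → ¬ Covers N (entry ea) (g t)
  χ-avoids≡0⇔ N ea = ⇔.trans (sum<≡0⇔ _ _) (All<-cong N λ t →
    ⇔.trans (notᵗ≡0⇔≢0 _) (→-cong-⇔ (χ-covers≡0⇔ N ea (g t)) ⇔.refl))

  χ-approx≡0⇔ : ∀ N w ea er → χ-approx N w ea er ≡ 0 ⇔ Approx N (entry w) (entry ea) (entry er)
  χ-approx≡0⇔ N w ea er = mk⇔ approx-of χ-of
    where
    open Equivalence
    approx-of : χ-approx N w ea er ≡ 0 → Approx N (entry w) (entry ea) (entry er)
    approx-of e = record
      { bounded    = to (χ-bounded≡0⇔ N ea er) (m+n≡0⇒m≡0 (χ-bounded N ea er) e₁₂)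
      ; disjoint   = to (χ-disjoint≡0⇔ N er) (m+n≡0⇒n≡0 (χ-bounded N ea er) e₁₂)
      ; consistent = to (χ-consistent≡0⇔ N w ea er) (m+n≡0⇒n≡0 (χ-bounded N ea er + χ-disjoint N er) e₁₂₃)
      ; avoids     = to (χ-avoids≡0⇔ N ea) (m+n≡0⇒n≡0 (χ-bounded N ea er + χ-disjoint N er + χ-consistent N w ea er) e)
      }
      where
      e₁₂₃ = m+n≡0⇒m≡0 (χ-bounded N ea er + χ-disjoint N er + χ-consistent N w ea er) e
      e₁₂  = m+n≡0⇒m≡0 (χ-bounded N ea er + χ-disjoint N er) e₁₂₃
    χ-of : Approx N (entry w) (entry ea) (entry er) → χ-approx N w ea er ≡ 0
    χ-of A = m≡0∧n≡0⇒m+n≡0 (m≡0∧n≡0⇒m+n≡0 (m≡0∧n≡0⇒m+n≡0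
      (from (χ-bounded≡0⇔ N ea er) bounded) (from (χ-disjoint≡0⇔ N er) disjoint))
      (from (χ-consistent≡0⇔ N w ea er) consistent)) (from (χ-avoids≡0⇔ N ea) avoids)
      where open Approx A

  χ-noApproxRow : ℕ → ℕ → ℕ → ℕ
  χ-noApproxRow N w ea = sum< (suc (encode N (λ _ → period N))) λ er → notᵗ (χ-approx N w ea er)

  χ-noApprox : ℕ → ℕ → ℕ
  χ-noApprox N w = sum< (suc (encode N (λ _ → k))) (χ-noApproxRow N w)

  -- Every approximation has its codes below the search bounds of χ-noApprox.
  χ-noApprox≡0⇒¬Approx : ∀ N w → χ-noApprox N w ≡ 0 → ∀ {a r} → ¬ Approx N (entry w) a r
  χ-noApprox≡0⇒¬Approx N w e {a} {r} A =
    Equivalence.to (notᵗ≡0⇔≢0 _) (Equivalence.to (sum<≡0⇔ _ _) (Equivalence.to (sum<≡0⇔ _ _) e ea ea≤) er er≤)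
      (Equivalence.from (χ-approx≡0⇔ N w ea er)
        (Approx-cong (λ _ _ → refl) (λ j j<N → sym (entry-encode N a j j<N)) (λ j j<N → sym (entry-encode N r j j<N)) A))
    where
    open Approx A
    ea = encode N a
    er = encode N r
    ea≤ : ea < suc (encode N (λ _ → k))
    ea≤ = s≤s (encode-mono N (λ j j<N → <⇒≤ (proj₁ (bounded j j<N))))
    er≤ : er < suc (encode N (λ _ → period N))
    er≤ = s≤s (encode-mono N (λ j j<N → ≤-trans (<⇒≤ (proj₂ (bounded j j<N))) (^-monoʳ-≤ 2 (s≤s (<⇒≤ j<N)))))

  χ-noApprox≢0⇒Approx : ∀ N w → χ-noApprox N w ≢ 0 → ∃ λ a → ∃ λ r → Approx N (entry w) a r
  χ-noApprox≢0⇒Approx N w ne with sum<≢0⇒∃ (suc (encode N (λ _ → k))) (χ-noApproxRow N w) ne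
  ... | ea , _ , ne₁ with sum<≢0⇒∃ (suc (encode N (λ _ → period N))) (λ er → notᵗ (χ-approx N w ea er)) ne₁
  ... | er , _ , ne₂ = entry ea , entry er , Equivalence.to (χ-approx≡0⇔ N w ea er) (notᵗ≢0⇒≡0 _ ne₂)

  forbidden : ℕ → ℕ
  forbidden n = if0 χ-noApprox (unpair₁ n) (unpair₂ n) then wordCode (unpair₁ n) (unpair₂ n) else emptyCode k

  open Relative g

  χ-entryᴾ : Definable 3 (χ-entry $ⁿ_)
  χ-entryᴾ = respᴾ (comp₂ addᴾ (comp₂ monusᴾ (comp₁ succᴾ (comp₁ unpair₁ᴾ π₂)) π₀)
                               (comp₂ distᴾ (comp₂ entryᴾ π₁ (comp₁ unpair₁ᴾ π₂)) (comp₁ unpair₂ᴾ π₂)))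
                   (λ { (N ∷ ea ∷ q ∷ []) → refl })

  χ-coversᴾ : Definable 3 (χ-covers $ⁿ_)
  χ-coversᴾ = respᴾ (comp₄ (sum<ᴾ (comp₃ χ-entryᴾ π₁ π₂ (comp₂ entryᴾ (comp₁ unpair₂ᴾ π₃) π₀))) (comp₁ unpair₁ᴾ π₂) π₀ π₁ π₂)
                    (λ { (N ∷ ea ∷ p ∷ []) → refl })

  χ-boundedᴾ : Definable 3 (χ-bounded $ⁿ_)
  χ-boundedᴾ = respᴾ (comp₄ (sum<ᴾ term) π₀ π₀ π₁ π₂) (λ { (N ∷ ea ∷ er ∷ []) → refl })
    where
    term : Definable 4 ((λ n N ea er → (suc (entry ea n) ∸ k) + (suc (entry er n) ∸ period n)) $ⁿ_)
    term = respᴾ (comp₂ addᴾ (comp₂ monusᴾ (comp₁ succᴾ (comp₂ entryᴾ π₂ π₀)) (constᴾ k))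
                             (comp₂ monusᴾ (comp₁ succᴾ (comp₂ entryᴾ π₃ π₀)) (comp₁ periodᴾ π₀)))
                 (λ { (_ ∷ _ ∷ _ ∷ _ ∷ []) → refl })

  χ-disjointᴾ : Definable 2 (χ-disjoint $ⁿ_)
  χ-disjointᴾ = respᴾ (comp₃ (sum<ᴾ sum-m) π₀ π₀ π₁) (λ { (N ∷ er ∷ []) → refl })
    where
    term : Definable 4 ((λ n m c er → notᵗ (χ-level c m (entry er m) + χ-level c n (entry er n)) * ∣ m - n ∣) $ⁿ_)
    term = respᴾ (comp₂ mulᴾ (comp₁ notᴾ (comp₂ addᴾ (comp₃ χ-levelᴾ π₂ π₁ (comp₂ entryᴾ π₃ π₁))
                                                     (comp₃ χ-levelᴾ π₂ π₀ (comp₂ entryᴾ π₃ π₀))))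
                             (comp₂ distᴾ π₁ π₀))
                 (λ { (_ ∷ _ ∷ _ ∷ _ ∷ []) → refl })
    sum-n : Definable 4 ((λ m c N er → sum< N λ n →
                           notᵗ (χ-level c m (entry er m) + χ-level c n (entry er n)) * ∣ m - n ∣) $ⁿ_)
    sum-n = respᴾ (comp₄ (sum<ᴾ term) π₂ π₀ π₁ π₃) (λ { (_ ∷ _ ∷ _ ∷ _ ∷ []) → refl })
    sum-m : Definable 3 ((λ c N er → sum< N λ m → sum< N λ n →
                           notᵗ (χ-level c m (entry er m) + χ-level c n (entry er n)) * ∣ m - n ∣) $ⁿ_)
    sum-m = respᴾ (comp₄ (sum<ᴾ sum-n) π₁ π₀ π₁ π₂) (λ { (_ ∷ _ ∷ _ ∷ []) → refl })

  χ-consistentᴾ : Definable 4 (χ-consistent $ⁿ_)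
  χ-consistentᴾ = respᴾ (comp₅ (sum<ᴾ sum-n) π₀ π₀ π₁ π₂ π₃) (λ { (N ∷ w ∷ ea ∷ er ∷ []) → refl })
    where
    term : Definable 5 ((λ n c w ea er → notᵗ (χ-level c n (entry er n)) * ∣ entry w c - entry ea n ∣) $ⁿ_)
    term = respᴾ (comp₂ mulᴾ (comp₁ notᴾ (comp₃ χ-levelᴾ π₁ π₀ (comp₂ entryᴾ π₄ π₀)))
                             (comp₂ distᴾ (comp₂ entryᴾ π₂ π₁) (comp₂ entryᴾ π₃ π₀)))
                 (λ { (_ ∷ _ ∷ _ ∷ _ ∷ _ ∷ []) → refl })
    sum-n : Definable 5 ((λ c N w ea er → sum< N λ n →
                           notᵗ (χ-level c n (entry er n)) * ∣ entry w c - entry ea n ∣) $ⁿ_)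
    sum-n = respᴾ (comp₅ (sum<ᴾ term) π₁ π₀ π₂ π₃ π₄) (λ { (_ ∷ _ ∷ _ ∷ _ ∷ _ ∷ []) → refl })

  χ-avoidsᴾ : Definable 2 (χ-avoids $ⁿ_)
  χ-avoidsᴾ = respᴾ (comp₃ (sum<ᴾ (comp₁ notᴾ (comp₃ χ-coversᴾ π₁ π₂ (comp₁ oracleᴾ π₀)))) π₀ π₀ π₁)
                    (λ { (N ∷ ea ∷ []) → refl })

  χ-approxᴾ : Definable 4 (χ-approx $ⁿ_)
  χ-approxᴾ = respᴾ (comp₂ addᴾ (comp₂ addᴾ (comp₂ addᴾ (comp₃ χ-boundedᴾ π₀ π₂ π₃) (comp₂ χ-disjointᴾ π₀ π₃))
                                            (comp₄ χ-consistentᴾ π₀ π₁ π₂ π₃))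
                                (comp₂ χ-avoidsᴾ π₀ π₂))
                    (λ { (N ∷ w ∷ ea ∷ er ∷ []) → refl })

  χ-noApproxᴾ : Definable 2 (χ-noApprox $ⁿ_)
  χ-noApproxᴾ = respᴾ (comp₃ (sum<ᴾ rowᴾ) (comp₁ succᴾ (comp₂ constEncodeᴾ π₀ (constᴾ k))) π₀ π₁)
                      (λ { (N ∷ w ∷ []) → refl })
    where
    rowᴾ : Definable 3 ((λ ea N w → χ-noApproxRow N w ea) $ⁿ_)
    rowᴾ = respᴾ (comp₄ (sum<ᴾ (comp₁ notᴾ (comp₄ χ-approxᴾ π₂ π₃ π₁ π₀)))
                        (comp₁ succᴾ (comp₂ constEncodeᴾ π₁ (comp₁ periodᴾ π₁))) π₀ π₁ π₂)
                 (λ { (_ ∷ _ ∷ _ ∷ []) → refl })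

  forbiddenᴾ : Definable 1 (forbidden $ⁿ_)
  forbiddenᴾ = respᴾ (comp₃ if0ᴾ (comp₂ χ-noApproxᴾ (comp₁ unpair₁ᴾ π₀) (comp₁ unpair₂ᴾ π₀))
                                 (comp₂ wordCodeᴾ (comp₁ unpair₁ᴾ π₀) (comp₁ unpair₂ᴾ π₀))
                                 (constᴾ (emptyCode k)))
                     (λ { (n ∷ []) → refl })

¬∀⇒∃¬ : ExcludedMiddle 0ℓ → ∀ {P : ℕ → Set} → ¬ (∀ n → P n) → ∃ λ n → ¬ P n
¬∀⇒∃¬ em {P} ¬∀ with em {∃ λ n → ¬ P n}
... | yes ∃¬ = ∃¬
... | no ¬∃¬ = ⊥-elim (¬∀ λ n → em⇒dne em (λ ¬Pn → ¬∃¬ (n , ¬Pn)))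

uniform-bound : ∀ {P : ℕ → ℕ → Set} B → (∀ {i M M′} → M ≤ M′ → P i M → P i M′) →
  All< B (λ i → ∃ (P i)) → ∃ λ M → All< B (λ i → P i M)
uniform-bound zero    up h = 0 , λ _ ()
uniform-bound (suc B) up h with uniform-bound B up (λ i i<B → h i (m<n⇒m<1+n i<B)) | h B ≤-refl
... | M₁ , below-B | M₂ , at-B = M₁ ⊔ M₂ , λ i i<1+B → case m≤n⇒m<n∨m≡n (s≤s⁻¹ i<1+B) of λ where
  (inj₁ i<B)  → up (m≤m⊔n M₁ M₂) (below-B i i<B)
  (inj₂ refl) → up (m≤n⊔m M₁ M₂) at-B

_[_≔_] : (ℕ → ℕ) → ℕ → ℕ → ℕ → ℕ
(f [ N ≔ v ]) j with j ℕ.≟ N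
... | yes _ = v
... | no  _ = f j

Agree-extend : ∀ {N f f′ v} → Agree N f f′ → v ≡ f′ N → Agree (suc N) (f [ N ≔ v ]) f′
Agree-extend {N} f≗f′ v≡ j j<1+N with j ℕ.≟ N | m≤n⇒m<n∨m≡n (s≤s⁻¹ j<1+N)
... | yes refl | _         = v≡
... | no  _    | inj₁ j<N  = f≗f′ j j<N
... | no  j≢N  | inj₂ j≡N  = ⊥-elim (j≢N j≡N)

[≔]-at : ∀ f N v → (f [ N ≔ v ]) N ≡ v
[≔]-at f N v with N ℕ.≟ N
... | yes _   = refl
... | no  N≢N = ⊥-elim (N≢N refl)

module König (em : ExcludedMiddle 0ℓ) (k : ℕ) (B : ℕ → ℕ) (Good : ℕ → (ℕ → ℕ) → (ℕ → ℕ) → Set)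
  (Good-mono : ∀ {M N a r} → M ≤ N → Good N a r → Good M a r)
  (Good-cong : ∀ {N a r a′ r′} → Agree N a a′ → Agree N r r′ → Good N a r → Good N a′ r′)
  (Good-bounded : ∀ {N a r} → Good (suc N) a r → a N < k × r N < B N)
  (Good-everywhere : ∀ N → ∃ λ a → ∃ λ r → Good N a r) where

  ExtendsTo : ℕ → (ℕ → ℕ) → (ℕ → ℕ) → ℕ → Set
  ExtendsTo N a r M = ∃ λ a′ → ∃ λ r′ → Agree N a a′ × Agree N r r′ × Good M a′ r′

  Extendable : ℕ → (ℕ → ℕ) → (ℕ → ℕ) → Set
  Extendable N a r = ∀ M → ExtendsTo N a r M

  ExtendsTo-down : ∀ {N a r M M′} → M ≤ M′ → ExtendsTo N a r M′ → ExtendsTo N a r M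
  ExtendsTo-down M≤M′ (a′ , r′ , a≗ , r≗ , good) = a′ , r′ , a≗ , r≗ , Good-mono M≤M′ good

  -- If no child (l , s) were extendable, one depth M would kill all of the finitely many
  -- children at once, while an extension of the parent to depth M ⊔ (N + 1) passes through one.
  extend : ∀ {N a r} → Extendable N a r → ∃ λ l → ∃ λ s → Extendable (suc N) (a [ N ≔ l ]) (r [ N ≔ s ])
  extend {N} {a} {r} ext with em {∃ λ l → ∃ λ s → Extendable (suc N) (a [ N ≔ l ]) (r [ N ≔ s ])}
  ... | yes child = child
  ... | no  none  = ⊥-elim (¬child (a′ , r′ , a≗ , r≗ , Good-mono (m≤m⊔n M (suc N)) good))
    where
    Dead : ℕ → ℕ → ℕ → Set
    Dead l s M = ¬ ExtendsTo (suc N) (a [ N ≔ l ]) (r [ N ≔ s ]) M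
    dead : ∀ l s → ∃ (Dead l s)
    dead l s = ¬∀⇒∃¬ em (λ ext′ → none (l , s , ext′))
    Dead-up : ∀ {l s M M′} → M ≤ M′ → Dead l s M → Dead l s M′
    Dead-up M≤M′ dead-M e = dead-M (ExtendsTo-down M≤M′ e)
    all-dead : ∃ λ M → All< k λ l → All< (B N) λ s → Dead l s M
    all-dead = uniform-bound k (λ M≤M′ h s s<B → Dead-up M≤M′ (h s s<B))
                 (λ l _ → uniform-bound (B N) Dead-up (λ s _ → dead l s))
    M = proj₁ all-dead
    extension = ext (M ⊔ suc N)
    a′ = proj₁ extension
    r′ = proj₁ (proj₂ extension)
    a≗ = Agree-extend (proj₁ (proj₂ (proj₂ extension))) refl
    r≗ = Agree-extend (proj₁ (proj₂ (proj₂ (proj₂ extension)))) refl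
    good = proj₂ (proj₂ (proj₂ (proj₂ extension)))
    ¬child : Dead (a′ N) (r′ N) M
    ¬child = let (l<k , s<B) = Good-bounded (Good-mono (m≤n⊔m M (suc N)) good) in
      proj₂ all-dead (a′ N) l<k (r′ N) s<B

  Node : ℕ → Set
  Node N = ∃ λ a → ∃ λ r → Extendable N a r

  next : ∀ {N} → Node N → Node (suc N)
  next {N} (a , r , ext) = let (l , s , ext′) = extend ext in a [ N ≔ l ] , r [ N ≔ s ] , ext′

  node : ∀ N → Node N
  node zero    = (λ _ → 0) , (λ _ → 0) , λ M →
    let (a , r , good) = Good-everywhere M in a , r , (λ _ ()) , (λ _ ()) , good
  node (suc N) = next (node N)

  a∞ : ℕ → ℕ
  a∞ j = proj₁ (node (suc j)) j

  r∞ : ℕ → ℕ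
  r∞ j = proj₁ (proj₂ (node (suc j))) j

  node-agrees : ∀ N → Agree N (proj₁ (node N)) a∞ × Agree N (proj₁ (proj₂ (node N))) r∞
  node-agrees zero    = (λ _ ()) , (λ _ ())
  node-agrees (suc N) = Agree-extend (proj₁ (node-agrees N)) (sym ([≔]-at _ N _)) ,
                        Agree-extend (proj₂ (node-agrees N)) (sym ([≔]-at _ N _))

  branch : ∀ N → Good N a∞ r∞
  branch N =
    let (a′ , r′ , a≗ , r≗ , good) = proj₂ (proj₂ (node N)) N
        (a≗a∞ , r≗r∞) = node-agrees N
    in Good-cong (λ j j<N → trans (sym (a≗ j j<N)) (a≗a∞ j j<N)) (λ j j<N → trans (sym (r≗ j j<N)) (r≗r∞ j j<N)) good

module Forbidden (k : ℕ) (S : Seq k → Set) (g : ℕ → ℕ)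
  (S-closed : ∀ α → (¬ S α) ⇔ (∃ λ n → inCylℕ α (decodePatℕ (g n)))) where

  open Approximation k g

  DS⇒Approx : ∀ {x} → DS S x → ∀ N → ∃ λ a → ∃ λ r → Approx N (letters x) a r
  DS⇒Approx {x} (α , Sα , kk , net , x≡α) N = toℕ ∘ α , r , record
    { bounded    = λ n _ → toℕ<n (α n) , proj₁ (proj₂ (level-residue kk n))
    ; disjoint   = λ c _ m _ n _ (on-m , on-n) → case m ℕ.≟ n of λ where
                     (yes m≡n) → m≡n
                     (no  m≢n) → ⊥-elim (net m n m≢n _ (level m c on-m , level n c on-n))
    ; consistent = λ c _ n _ on-n → cong toℕ (x≡α n _ (level n c on-n))
    ; avoids     = λ t _ covers → Equivalence.from (S-closed α) (t , All.map proj₂ covers) Sα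
    }
    where
    r : ℕ → ℕ
    r n = proj₁ (level-residue kk n)
    level : ∀ n c → OnLevel r n c → InLevel kk n (decodeℤ c)
    level n c = Equivalence.from (proj₂ (proj₂ (level-residue kk n)) (decodeℤ c))

  Approx-limit⇒DS : ExcludedMiddle 0ℓ → ∀ {x a r} → (∀ N → Approx N (letters x) a r) → DS S x
  Approx-limit⇒DS em {x} {a} {r} approx = α , Sα , +_ ∘ r , net , x≡α
    where
    open module Approx-at N = Approx (approx N)
    a<k : ∀ j → a j < k
    a<k j = proj₁ (bounded (suc j) j ≤-refl)
    α : Seq k
    α j = fromℕ< (a<k j)
    α≡a : ∀ j → toℕ (α j) ≡ a j
    α≡a j = toℕ-fromℕ< (a<k j)
    on-level : ∀ {n i} → InLevel (+_ ∘ r) n i → OnLevel r n (encodeℤ i)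
    on-level {i = i} = subst (InLevel (+_ ∘ r) _) (sym (decodeℤ-encodeℤ i))
    Sα : S α
    Sα = em⇒dne em λ ¬Sα →
      let (t , α∈) = Equivalence.to (S-closed α) ¬Sα
          (N , below) = positions-bounded (decodePatℕ (g t))
          N′ = suc t ⊔ N
      in avoids N′ t (m≤m⊔n (suc t) N)
           (All.zipWith (λ (i<N , αi≡) → <-≤-trans i<N (m≤n⊔m (suc t) N) , trans (sym (α≡a _)) αi≡) (below , α∈))
    net : IsNet (+_ ∘ r)
    net m n m≢n i (in-m , in-n) =
      m≢n (disjoint N c (lt (m≤m⊔n (suc c) (suc m))) m (lt (m≤n⊔m (suc c) (suc m))) n (m≤n⊔m (suc c ⊔ suc m) (suc n))
                      (on-level in-m , on-level in-n))
      where
      c = encodeℤ i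
      N = suc c ⊔ suc m ⊔ suc n
      lt : ∀ {j} → j < suc c ⊔ suc m → j < N
      lt j< = <-≤-trans j< (m≤m⊔n (suc c ⊔ suc m) (suc n))
    x≡α : ∀ n i → InLevel (+_ ∘ r) n i → x i ≡ α n
    x≡α n i in-n = toℕ-injective (begin
      toℕ (x i)         ≡⟨ cong (toℕ ∘ x) (sym (decodeℤ-encodeℤ i)) ⟩
      letters x c       ≡⟨ consistent N c (m≤m⊔n (suc c) (suc n)) n (m≤n⊔m (suc c) (suc n)) (on-level in-n) ⟩
      a n               ≡⟨ sym (α≡a n) ⟩
      toℕ (α n)         ∎)
      where
      open ≡-Reasoning
      c = encodeℤ i
      N = suc c ⊔ suc n

  forbidden-cases : ∀ n → (χ-noApprox (unpair₁ n) (unpair₂ n) ≡ 0 × forbidden n ≡ wordCode (unpair₁ n) (unpair₂ n))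
                          ⊎ forbidden n ≡ emptyCode k
  forbidden-cases n with χ-noApprox (unpair₁ n) (unpair₂ n)
  ... | zero  = inj₁ (refl , refl)
  ... | suc _ = inj₂ refl

  forbidden-pair : ∀ N w → χ-noApprox N w ≡ 0 → forbidden (pair N w) ≡ wordCode N w
  forbidden-pair N w none = begin
    forbidden (pair N w)
      ≡⟨ cong₂ (λ N′ w′ → if0 χ-noApprox N′ w′ then wordCode N′ w′ else emptyCode k) (unpair₁-pair N w) (unpair₂-pair N w) ⟩
    if0 χ-noApprox N w then wordCode N w else emptyCode k
      ≡⟨ cong (if0_then wordCode N w else emptyCode k) none ⟩
    wordCode N w ∎
    where open ≡-Reasoning

  forbidden-sound : ∀ x n → inCylℤ x (decodePatℤ (forbidden n)) → ¬ DS S x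
  forbidden-sound x n x∈ x∈DS with forbidden-cases n
  ... | inj₂ empty = emptyCode-empty x (subst (inCylℤ x ∘ decodePatℤ) empty x∈)
  ... | inj₁ (none , word) =
    let (a , r , A) = DS⇒Approx x∈DS (unpair₁ n)
        x≗w = Equivalence.to (inCyl-wordCode⇔ x (unpair₁ n) (unpair₂ n)) (subst (inCylℤ x ∘ decodePatℤ) word x∈)
    in χ-noApprox≡0⇒¬Approx (unpair₁ n) (unpair₂ n) none (Approx-cong x≗w (λ _ _ → refl) (λ _ _ → refl) A)

  forbidden-complete : ExcludedMiddle 0ℓ → ∀ x → ¬ DS S x → ∃ λ n → inCylℤ x (decodePatℤ (forbidden n))
  forbidden-complete em x x∉DS with em {∃ λ N → χ-noApprox N (wordOf x N) ≡ 0}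
  ... | yes (N , none) = pair N (wordOf x N) ,
    subst (inCylℤ x ∘ decodePatℤ) (sym (forbidden-pair N (wordOf x N) none))
      (Equivalence.from (inCyl-wordCode⇔ x N (wordOf x N)) (λ c c<N → sym (entry-encode N (letters x) c c<N)))
  ... | no  always =
    ⊥-elim (x∉DS (Approx-limit⇒DS em (König.branch em k period (λ N → Approx N (letters x)) Approx-mono
                   (Approx-cong (λ _ _ → refl)) (λ A → Approx.bounded A _ ≤-refl) approx-at)))
    where
    approx-at : ∀ N → ∃ λ a → ∃ λ r → Approx N (letters x) a r
    approx-at N = let (a , r , A) = χ-noApprox≢0⇒Approx N (wordOf x N) (λ none → always (N , none)) in
      a , r , Approx-cong (λ c c<N → entry-encode N (letters x) c c<N) (λ _ _ → refl) (λ _ _ → refl) A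

InLevel-translate : ∀ kk d n i → InLevel (λ m → kk m ℤ.- d) n i → InLevel kk n (i ℤ.+ d)
InLevel-translate kk d n i (z , i≡) = z , trans (cong (ℤ._+ d) i≡) (cancel z (+ period n) (kk n) d)
  where
  cancel : ∀ a b c d → a ℤ.* b ℤ.+ (c ℤ.- d) ℤ.+ d ≡ a ℤ.* b ℤ.+ c
  cancel = solve-∀

D-translate : ∀ {k} {α : Seq k} {x : Conf k} d → D α x → D α (λ i → x (i ℤ.+ d))
D-translate d (kk , net , x≡α) =
  (λ m → kk m ℤ.- d) ,
  (λ m n m≢n i (in-m , in-n) → net m n m≢n (i ℤ.+ d) (InLevel-translate kk d m i in-m , InLevel-translate kk d n i in-n)) ,
  (λ n i in-n → x≡α n (i ℤ.+ d) (InLevel-translate kk d n i in-n))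

D-resp : ∀ {k} {α : Seq k} {x y : Conf k} → (∀ i → x i ≡ y i) → D α x → D α y
D-resp x≗y (kk , net , x≡α) = kk , net , λ n i in-n → trans (sym (x≗y i)) (x≡α n i in-n)

DS-shiftInvariant : ∀ {k} (S : Seq k → Set) → ShiftInvariant (DS S)
DS-shiftInvariant S x = mk⇔
  (λ (α , Sα , x∈D) → α , Sα , D-translate (+ 1) x∈D)
  (λ (α , Sα , shift-x∈D) → α , Sα , D-resp (λ i → cong x (-1+1 i)) (D-translate -[1+ 0 ] shift-x∈D))
  where
  -1+1 : ∀ i → i ℤ.+ -[1+ 0 ] ℤ.+ + 1 ≡ i
  -1+1 = solve-∀

corollary1 : ExcludedMiddle 0ℓ → (k : ℕ) → (S : Seq k → Set) →
    Saturated S → EffClosedℕ S → EffectiveSubshift (DS S)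
corollary1 em k S _ (g , g-computable , S-closed) =
  (forbidden , Definable⇒Computable g-computable forbiddenᴾ ,
    λ x → mk⇔ (forbidden-complete em x) (λ (n , x∈) → forbidden-sound x n x∈)) ,
  DS-shiftInvariant S
  where
  open Approximation k g using (forbidden; forbiddenᴾ)
  open Forbidden k S g S-closed
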